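{- Let $G$ be a nontrivial connected graph of order $n\ge 5$. Then $\gamma_{tR2}(G)=3$ if and only if either $G$ has exactly one vertex of degree $n-1$, or $\Delta(G)\le n-2$ and $G$ is obtained from two disjoint graphs $G_1$ and $G_2$, where $G_1\in\{P_3,C_3\}$ and $G_2$ is any graph of order $n-3$, by adding edges between vertices of $G_1$ and vertices of $G_2$ so that every vertex of $G_2$ has at least two neighbors in $G_1$.
   Context: All graphs are finite and simple; $\Delta(G)$ is the maximum degree. For $f:V(G)\to\{0,1,2\}$ let $V_i=\{v:f(v)=i\}$; $f$ is a total Roman $\{2\}$-dominating function (TR2DF) if every vertex $v$ with $f(v)=0$ has a neighbor $u$ with $f(u)=2$ or two distinct neighbors $x,y$ with $f(x)=f(y)=1$, and the subgraph induced by $V_1\cup V_2$ has no isolated vertices. $\gamma_{tR2}(G)$ is the minimum weight $\sum_v f(v)$ of a TR2DF of $G$. -}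

module Defs where

open import Data.Nat using (ℕ; zero; suc; _+_; _∸_; _≤_)
open import Data.Fin using (Fin)
open import Data.Bool using (Bool; true; false; if_then_else_)
open import Data.List using (List; map; allFin)
open import Data.Nat.ListAction using (sum)
open import Data.Product using (Σ; ∃; ∃-syntax; _×_; _,_)
open import Data.Sum using (_⊎_)
open import Relation.Nullary using (¬_)
open import Relation.Binary.PropositionalEquality using (_≡_; _≢_)

record Graph (n : ℕ) : Set where
  field
    E     : Fin n → Fin n → Bool
    sym   : ∀ u v → E u v ≡ E v u
    irrfl : ∀ v → E v v ≡ false

open Graph public

Adj : ∀ {n} → Graph n → Fin n → Fin n → Set
Adj G u v = E G u v ≡ true

degree : ∀ {n} → Graph n → Fin n → ℕ
degree {n} G v = sum (map (λ u → if E G v u then 1 else 0) (allFin n))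

data Walk {n : ℕ} (G : Graph n) : Fin n → Fin n → Set where
  here : ∀ {v} → Walk G v v
  step : ∀ {u w v} → Adj G u w → Walk G w v → Walk G u v

Connected : ∀ {n} → Graph n → Set
Connected {n} G = ∀ (u v : Fin n) → Walk G u v

weight : ∀ {n} → (Fin n → ℕ) → ℕ
weight {n} f = sum (map f (allFin n))

IsTR2DF : ∀ {n} → Graph n → (Fin n → ℕ) → Set
IsTR2DF {n} G f =
    (∀ v → f v ≤ 2)
  × (∀ v → f v ≡ 0 →
        (∃[ u ] (Adj G v u × f u ≡ 2))
      ⊎ (∃[ x ] ∃[ y ] (x ≢ y × Adj G v x × Adj G v y × f x ≡ 1 × f y ≡ 1)))
    -- the subgraph induced by V₁ ∪ V₂ has no isolated vertex
  × (∀ v → f v ≢ 0 → ∃[ u ] (Adj G v u × f u ≢ 0))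

γtR2≡ : ∀ {n} → Graph n → ℕ → Set
γtR2≡ G k =
    (∃[ f ] (IsTR2DF G f × weight f ≡ k))
  × (∀ f → IsTR2DF G f → k ≤ weight f)

Δ≤ : ∀ {n} → Graph n → ℕ → Set
Δ≤ {n} G k = ∀ (v : Fin n) → degree G v ≤ k

ExactlyOneFullVertex : ∀ {n} → Graph n → Set
ExactlyOneFullVertex {n} G =
  ∃[ v ] (degree G v ≡ n ∸ 1 × (∀ w → degree G w ≡ n ∸ 1 → w ≡ v))

InducesP3 : ∀ {n} → Graph n → Fin n → Fin n → Fin n → Set
InducesP3 G a b c =
    (Adj G a b × Adj G b c × ¬ Adj G a c)
  ⊎ (Adj G b a × Adj G a c × ¬ Adj G b c)
  ⊎ (Adj G a c × Adj G c b × ¬ Adj G a b)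

InducesC3 : ∀ {n} → Graph n → Fin n → Fin n → Fin n → Set
InducesC3 G a b c = Adj G a b × Adj G b c × Adj G a c

P3C3Construction : ∀ {n} → Graph n → Set
P3C3Construction {n} G =
  ∃[ a ] ∃[ b ] ∃[ c ]
    ( a ≢ b × b ≢ c × a ≢ c
    × (InducesP3 G a b c ⊎ InducesC3 G a b c)
    × (∀ v → v ≢ a → v ≢ b → v ≢ c →
          (Adj G v a × Adj G v b) ⊎ (Adj G v a × Adj G v c) ⊎ (Adj G v b × Adj G v c)))

-- A TR2DF of weight at most 2 is positive on both ends a, b of some edge (by
-- totality), hence equals 1 on a and b and 0 elsewhere, and then every other vertex
-- must be adjacent to both: a and b are universal (of degree n − 1).  As two
-- universal vertices do carry such a function, γ_tR2(G) ≥ 3 iff G has at most one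
-- universal vertex.  In a TR2DF of weight 3, a vertex u of value 2 is universal:
-- a vertex w not adjacent to u would need weight at least 2 besides u, either to be
-- dominated or, if f(w) > 0, together with a positive neighbour.  So if G has a
-- universal vertex u, then 2 on u and 1 on some other vertex is optimal; otherwise
-- Δ(G) ≤ n − 2, an optimal function is the indicator of three vertices, totality
-- makes them induce P₃ or C₃, and domination makes every other vertex adjacent to
-- two of them.  Conversely the indicator of G₁ in that construction is a TR2DF of
-- weight 3.
module Submission where

open import Defs hiding (sym)
open import Data.Nat using (ℕ; zero; suc; _+_; _*_; _∸_; _≤_; _<_; _≤?_; z≤n; s≤s)
open import Data.Nat.Properties
  using (≤-refl; ≤-reflexive; ≤-trans; ≤-antisym; ≤-pred; ≰⇒>; <⇒≱; <⇒≢; ≤∧≢⇒<; <-irrefl; n<1+n; 1+n≰n;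
         m≤n⇒m≤1+n; n≢0⇒n>0; 1+n≢0; n≤0⇒n≡0; m≤m+n; m≤n+m∸n; +-identityʳ; +-suc; *-zeroʳ; *-identityʳ;
         +-mono-≤; +-monoˡ-≤; +-monoʳ-≤; +-mono-<-≤; +-mono-≤-<; +-cancelˡ-≡; +-cancelˡ-≤; +-cancelʳ-≤;
         +-commutativeSemigroup; module ≤-Reasoning)
  renaming (_≟_ to _≟ℕ_)
open import Algebra.Properties.CommutativeSemigroup +-commutativeSemigroup using (x∙yz≈y∙xz)
open import Data.Fin using (Fin; zero; suc; _≟_)
open import Data.Fin.Properties using (any?; punchInᵢ≢i)
open import Data.Bool using (true; false; if_then_else_)
open import Data.Bool.Properties using () renaming (_≟_ to _≟B_)
open import Data.List using (List; []; _∷_; map; length; allFin)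
open import Data.List.Properties using (map-tabulate; map-cong; map-cong-local)
open import Data.List.Membership.Propositional using (_∈_; _∉_)
open import Data.List.Relation.Unary.Any as Any using (here; there)
open import Data.List.Relation.Unary.All as All using (All; []; _∷_)
open import Data.List.Relation.Unary.All.Properties using (¬Any⇒All¬; All¬⇒¬Any)
open import Data.List.Relation.Unary.AllPairs using ([]; _∷_)
open import Data.List.Relation.Unary.Unique.Propositional using (Unique)
open import Data.Nat.ListAction using (sum)
open import Data.Vec.Functional using (updateAt)
open import Data.Vec.Functional.Properties using (updateAt-updates; updateAt-minimal)
open import Data.Product using (∃-syntax; _×_; _,_; proj₁; proj₂)
open import Data.Sum using (_⊎_; inj₁; inj₂)
open import Data.Empty using (⊥; ⊥-elim)
open import Function using (_∘_; id; const)
open import Function.Bundles using (_⇔_; mk⇔)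
open import Relation.Nullary using (¬_; Dec; yes; no; contradiction; ¬?; _×-dec_)
open import Relation.Nullary.Decidable using (decidable-stable)
open import Relation.Binary.PropositionalEquality
  using (_≡_; _≢_; refl; sym; trans; cong; cong₂; subst; ≢-sym; module ≡-Reasoning)

private variable
  n : ℕ

weight-suc : (f : Fin (suc n) → ℕ) → weight f ≡ f zero + weight (f ∘ suc)
weight-suc {n = n} f =
  cong (λ xs → f zero + sum xs) (trans (map-tabulate suc f) (sym (map-tabulate {n = n} id (f ∘ suc))))

weight-cong : {f g : Fin n → ℕ} → (∀ x → f x ≡ g x) → weight f ≡ weight g
weight-cong {n = n} f≗g = cong sum (map-cong f≗g (allFin n))

weight-const : ∀ n k → weight {n} (const k) ≡ n * k
weight-const zero    k = refl
weight-const (suc n) k = trans (weight-suc {n} (const k)) (cong (k +_) (weight-const n k))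

weight-mono-≤ : {f g : Fin n → ℕ} → (∀ x → f x ≤ g x) → weight f ≤ weight g
weight-mono-≤ {zero}  f≤g = ≤-refl
weight-mono-≤ {suc n} {f} {g} f≤g = begin
  weight f                  ≡⟨ weight-suc f ⟩
  f zero + weight (f ∘ suc) ≤⟨ +-mono-≤ (f≤g zero) (weight-mono-≤ (f≤g ∘ suc)) ⟩
  g zero + weight (g ∘ suc) ≡⟨ weight-suc g ⟨
  weight g                  ∎
  where open ≤-Reasoning

weight-mono-< : {f g : Fin n → ℕ} (a : Fin n) → (∀ x → f x ≤ g x) → f a < g a → weight f < weight g
weight-mono-< {suc n} {f} {g} a f≤g fa<ga = begin-strict
  weight f                  ≡⟨ weight-suc f ⟩
  f zero + weight (f ∘ suc) <⟨ strictAt a fa<ga ⟩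
  g zero + weight (g ∘ suc) ≡⟨ weight-suc g ⟨
  weight g                  ∎
  where
  open ≤-Reasoning
  strictAt : (a : Fin (suc n)) → f a < g a → f zero + weight (f ∘ suc) < g zero + weight (g ∘ suc)
  strictAt zero    lt = +-mono-<-≤ lt (weight-mono-≤ (f≤g ∘ suc))
  strictAt (suc a) lt = +-mono-≤-< (f≤g zero) (weight-mono-< a (f≤g ∘ suc) lt)

weight-updateAt : (f : Fin n → ℕ) (a : Fin n) (h : ℕ → ℕ) →
                  f a + weight (updateAt f a h) ≡ h (f a) + weight f
weight-updateAt {suc n} f zero h = begin
  f zero + weight (updateAt f zero h)      ≡⟨ cong (f zero +_) (weight-suc (updateAt f zero h)) ⟩
  f zero + (h (f zero) + weight (f ∘ suc)) ≡⟨ x∙yz≈y∙xz (f zero) (h (f zero)) _ ⟩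
  h (f zero) + (f zero + weight (f ∘ suc)) ≡⟨ cong (h (f zero) +_) (weight-suc f) ⟨
  h (f zero) + weight f                    ∎
  where open ≡-Reasoning
weight-updateAt {suc n} f (suc a) h = begin
  f (suc a) + weight (updateAt f (suc a) h)
    ≡⟨ cong (f (suc a) +_) (weight-suc (updateAt f (suc a) h)) ⟩
  f (suc a) + (f zero + weight (updateAt (f ∘ suc) a h))
    ≡⟨ x∙yz≈y∙xz (f (suc a)) (f zero) _ ⟩
  f zero + (f (suc a) + weight (updateAt (f ∘ suc) a h))
    ≡⟨ cong (f zero +_) (weight-updateAt (f ∘ suc) a h) ⟩
  f zero + (h (f (suc a)) + weight (f ∘ suc))
    ≡⟨ x∙yz≈y∙xz (f zero) (h (f (suc a))) _ ⟩
  h (f (suc a)) + (f zero + weight (f ∘ suc))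
    ≡⟨ cong (h (f (suc a)) +_) (weight-suc f) ⟨
  h (f (suc a)) + weight f
    ∎
  where open ≡-Reasoning

SupportedOn : (Fin n → ℕ) → List (Fin n) → Set
SupportedOn f xs = ∀ x → x ∉ xs → f x ≡ 0

nonzero⇒∈ : {f : Fin n → ℕ} {xs : List (Fin n)} → SupportedOn f xs → ∀ {x} → f x ≢ 0 → x ∈ xs
nonzero⇒∈ {xs = xs} supp {x} fx≢0 with Any.any? (x ≟_) xs
... | yes x∈xs = x∈xs
... | no  x∉xs = contradiction (supp x x∉xs) fx≢0

map-erase : {f : Fin n → ℕ} {a : Fin n} {xs : List (Fin n)} →
            All (a ≢_) xs → map (updateAt f a (const 0)) xs ≡ map f xs
map-erase {f = f} {a} a∉xs = map-cong-local (All.map (λ {x} a≢x → updateAt-minimal x a f (≢-sym a≢x)) a∉xs)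

sum-≤-weight : {f : Fin n → ℕ} {xs : List (Fin n)} → Unique xs → sum (map f xs) ≤ weight f
sum-≤-weight []                                  = z≤n
sum-≤-weight {f = f} {xs = a ∷ xs} (a∉xs ∷ uniq) = begin
  f a + sum (map f xs)                        ≡⟨ cong (λ ys → f a + sum ys) (map-erase a∉xs) ⟨
  f a + sum (map (updateAt f a (const 0)) xs) ≤⟨ +-monoʳ-≤ (f a) (sum-≤-weight uniq) ⟩
  f a + weight (updateAt f a (const 0))       ≡⟨ weight-updateAt f a (const 0) ⟩
  weight f                                    ∎
  where open ≤-Reasoning

weight-supported : {f : Fin n → ℕ} {xs : List (Fin n)} → Unique xs → SupportedOn f xs → weight f ≡ sum (map f xs)
weight-supported {n} [] supp = trans (weight-cong (λ x → supp x λ ())) (trans (weight-const n 0) (*-zeroʳ n))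
weight-supported {f = f} {xs = a ∷ xs} (a∉xs ∷ uniq) supp = begin
  weight f                                    ≡⟨ weight-updateAt f a (const 0) ⟨
  f a + weight (updateAt f a (const 0))       ≡⟨ cong (f a +_) (weight-supported uniq erased-supp) ⟩
  f a + sum (map (updateAt f a (const 0)) xs) ≡⟨ cong (λ ys → f a + sum ys) (map-erase a∉xs) ⟩
  f a + sum (map f xs)                        ∎
  where
  open ≡-Reasoning
  erased-supp : SupportedOn (updateAt f a (const 0)) xs
  erased-supp x x∉xs with x ≟ a
  ... | yes refl = updateAt-updates a f
  ... | no  x≢a  = trans (updateAt-minimal x a f x≢a)
                         (supp x λ { (here x≡a) → x≢a x≡a ; (there x∈xs) → x∉xs x∈xs })

sum≡weight⇒supported : {f : Fin n → ℕ} {xs : List (Fin n)} → Unique xs → sum (map f xs) ≡ weight f → SupportedOn f xs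
sum≡weight⇒supported {f = f} {xs = xs} uniq s≡w x x∉xs =
  n≤0⇒n≡0 (+-cancelʳ-≤ (sum (map f xs)) (f x) 0 (begin
    f x + sum (map f xs) ≤⟨ sum-≤-weight (¬Any⇒All¬ xs x∉xs ∷ uniq) ⟩
    weight f             ≡⟨ s≡w ⟨
    sum (map f xs)       ∎))
  where open ≤-Reasoning

sum<weight⇒nonzero∉ : {f : Fin n → ℕ} {xs : List (Fin n)} →
                      Unique xs → sum (map f xs) < weight f → ∃[ x ] (x ∉ xs × f x ≢ 0)
sum<weight⇒nonzero∉ {f = f} {xs = xs} uniq s<w with any? (λ x → ¬? (Any.any? (x ≟_) xs) ×-dec ¬? (f x ≟ℕ 0))
... | yes found = found
... | no  none  = contradiction (sym (weight-supported uniq supp)) (<⇒≢ s<w)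
  where
  supp : SupportedOn f xs
  supp x x∉xs = decidable-stable (f x ≟ℕ 0) (λ fx≢0 → none (x , x∉xs , fx≢0))

2≤sum-pair : (f : Fin n → ℕ) {x y : Fin n} → f x ≢ 0 → f y ≢ 0 → 2 ≤ sum (map f (x ∷ y ∷ []))
2≤sum-pair f {y = y} fx≢0 fy≢0 = +-mono-≤ (n≢0⇒n>0 fx≢0) (≤-trans (n≢0⇒n>0 fy≢0) (m≤m+n (f y) 0))

sum-ones : {f : Fin n → ℕ} {xs : List (Fin n)} → All (λ x → f x ≡ 1) xs → sum (map f xs) ≡ length xs
sum-ones []            = refl
sum-ones (fx≡1 ∷ ones) = cong₂ _+_ fx≡1 (sum-ones ones)

extendOnes : {f : Fin n → ℕ} {xs : List (Fin n)} → (∀ x → f x ≤ 1) →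
             Unique xs → All (λ x → f x ≡ 1) xs → length xs < weight f →
             ∃[ x ] (Unique (x ∷ xs) × All (λ x → f x ≡ 1) (x ∷ xs))
extendOnes {f = f} {xs} f≤1 uniq ones len<w
  with sum<weight⇒nonzero∉ uniq (subst (_< weight f) (sym (sum-ones ones)) len<w)
... | x , x∉xs , fx≢0 = x , ¬Any⇒All¬ xs x∉xs ∷ uniq , ≤-antisym (f≤1 x) (n≢0⇒n>0 fx≢0) ∷ ones

weight≡3⇒threeOnes : {f : Fin n → ℕ} → (∀ x → f x ≤ 1) → weight f ≡ 3 →
  ∃[ a ] ∃[ b ] ∃[ c ] let abc = a ∷ b ∷ c ∷ [] in
    Unique abc × All (λ x → f x ≡ 1) abc × SupportedOn f abc
weight≡3⇒threeOnes {f = f} f≤1 w≡3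
  with extendOnes f≤1 [] [] (subst (0 <_) (sym w≡3) (s≤s z≤n))
... | c , uc , oc with extendOnes f≤1 uc oc (subst (1 <_) (sym w≡3) (s≤s (s≤s z≤n)))
... | b , ubc , obc with extendOnes f≤1 ubc obc (subst (2 <_) (sym w≡3) ≤-refl)
... | a , uabc , oabc = a , b , c , uabc , oabc , sum≡weight⇒supported uabc (trans (sum-ones oabc) (sym w≡3))

-- Candidate TR2DFs are built as multiplicity functions of short lists of vertices,
-- e.g. multiplicity (u ∷ u ∷ w ∷ []) is 2 on u, 1 on w and 0 elsewhere.
multiplicity : List (Fin n) → Fin n → ℕ
multiplicity []       = const 0
multiplicity (a ∷ xs) = updateAt (multiplicity xs) a suc

multiplicity-here : (a : Fin n) (xs : List (Fin n)) → multiplicity (a ∷ xs) a ≡ suc (multiplicity xs a)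
multiplicity-here a xs = updateAt-updates a (multiplicity xs)

multiplicity-there : ∀ {a x : Fin n} (xs : List (Fin n)) → x ≢ a → multiplicity (a ∷ xs) x ≡ multiplicity xs x
multiplicity-there {a = a} {x} xs = updateAt-minimal x a (multiplicity xs)

weight-multiplicity : (xs : List (Fin n)) → weight (multiplicity xs) ≡ length xs
weight-multiplicity {n} []       = trans (weight-const n 0) (*-zeroʳ n)
weight-multiplicity {n} (a ∷ xs) = +-cancelˡ-≡ (m a) _ _ (begin
  m a + weight (multiplicity (a ∷ xs)) ≡⟨ weight-updateAt m a suc ⟩
  suc (m a) + weight m                 ≡⟨ +-suc (m a) _ ⟨
  m a + suc (weight m)                 ≡⟨ cong (λ k → m a + suc k) (weight-multiplicity xs) ⟩
  m a + suc (length xs)                ∎)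
  where
  open ≡-Reasoning
  m : Fin n → ℕ
  m = multiplicity xs

multiplicity-supported : (xs : List (Fin n)) → SupportedOn (multiplicity xs) xs
multiplicity-supported []       x _   = refl
multiplicity-supported (a ∷ xs) x x∉ =
  trans (multiplicity-there xs (x∉ ∘ here)) (multiplicity-supported xs x (x∉ ∘ there))

multiplicity-∈ : ∀ {x : Fin n} {xs} → x ∈ xs → multiplicity xs x ≢ 0
multiplicity-∈ {x = x} {_ ∷ xs} (here refl) = 1+n≢0 ∘ trans (sym (multiplicity-here x xs))
multiplicity-∈ {x = x} {a ∷ xs} (there x∈xs) with x ≟ a
... | yes refl = multiplicity-∈ {xs = _ ∷ xs} (here refl)
... | no  x≢a  = multiplicity-∈ x∈xs ∘ trans (sym (multiplicity-there xs x≢a))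

multiplicity-unique : ∀ {x : Fin n} {xs} → Unique xs → x ∈ xs → multiplicity xs x ≡ 1
multiplicity-unique {xs = a ∷ xs} (a∉xs ∷ _) (here refl) =
  trans (multiplicity-here a xs) (cong suc (multiplicity-supported xs a (All¬⇒¬Any a∉xs)))
multiplicity-unique {xs = _ ∷ xs} (a∉xs ∷ uniq) (there x∈xs) =
  trans (multiplicity-there xs (≢-sym (All.lookup a∉xs x∈xs))) (multiplicity-unique uniq x∈xs)

multiplicity-unique-≤1 : ∀ {xs : List (Fin n)} → Unique xs → ∀ x → multiplicity xs x ≤ 1
multiplicity-unique-≤1 {xs = xs} uniq x with Any.any? (x ≟_) xs
... | yes x∈xs = ≤-reflexive (multiplicity-unique uniq x∈xs)
... | no  x∉xs = subst (_≤ 1) (sym (multiplicity-supported xs x x∉xs)) z≤n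

both≡1 : ∀ {x y} → 1 ≤ x → 1 ≤ y → x + y ≤ 2 → x ≡ 1 × y ≡ 1
both≡1 {x} {y} 1≤x 1≤y x+y≤2 =
  ≤-antisym (+-cancelʳ-≤ 1 x 1 (≤-trans (+-monoʳ-≤ x 1≤y) x+y≤2)) 1≤x ,
  ≤-antisym (+-cancelˡ-≤ 1 y 1 (≤-trans (+-monoˡ-≤ y 1≤x) x+y≤2)) 1≤y

pattern 1st = here refl
pattern 2nd = there (here refl)
pattern 3rd = there (there (here refl))

module TotalRoman {n : ℕ} (G : Graph n) where

  Adj? : ∀ u v → Dec (Adj G u v)
  Adj? u v = E G u v ≟B true

  Adj-sym : ∀ {u v} → Adj G u v → Adj G v u
  Adj-sym {u} {v} = trans (Graph.sym G v u)

  Adj⇒≢ : ∀ {u v} → Adj G u v → u ≢ v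
  Adj⇒≢ {u} uu refl = contradiction (trans (sym (irrfl G u)) uu) λ ()

  Universal : Fin n → Set
  Universal v = ∀ w → w ≢ v → Adj G v w

  AtMostOneUniversal : Set
  AtMostOneUniversal = ∀ a b → Universal a → Universal b → a ≡ b

  Dominated : (Fin n → ℕ) → Fin n → Set
  Dominated f v = (∃[ u ] (Adj G v u × f u ≡ 2))
                ⊎ (∃[ x ] ∃[ y ] (x ≢ y × Adj G v x × Adj G v y × f x ≡ 1 × f y ≡ 1))

  NoIsolatedIn : List (Fin n) → Set
  NoIsolatedIn xs = All (λ p → ∃[ q ] (q ∈ xs × Adj G p q)) xs

  AdjacentToTwoOf : Fin n → Fin n → Fin n → Fin n → Set
  AdjacentToTwoOf v a b c =
    (Adj G v a × Adj G v b) ⊎ (Adj G v a × Adj G v c) ⊎ (Adj G v b × Adj G v c)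

  closedNeighbourhood : Fin n → Fin n → ℕ
  closedNeighbourhood v = updateAt (λ u → if E G v u then 1 else 0) v (const 1)

  weight-closedNeighbourhood : ∀ v → weight (closedNeighbourhood v) ≡ suc (degree G v)
  weight-closedNeighbourhood v =
    trans (cong (λ b → (if b then 1 else 0) + weight (closedNeighbourhood v)) (sym (irrfl G v)))
          (weight-updateAt (λ u → if E G v u then 1 else 0) v (const 1))

  closedNeighbourhood-≤1 : ∀ v u → closedNeighbourhood v u ≤ 1
  closedNeighbourhood-≤1 v u with u ≟ v
  ... | yes refl = ≤-reflexive (updateAt-updates v _)
  ... | no  u≢v  = subst (_≤ 1) (sym (updateAt-minimal u v _ u≢v)) (indicator≤1 (E G v u))
    where
    indicator≤1 : ∀ b → (if b then 1 else 0) ≤ 1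
    indicator≤1 true  = ≤-refl
    indicator≤1 false = z≤n

  weight-ones : weight {n} (const 1) ≡ n
  weight-ones = trans (weight-const n 1) (*-identityʳ n)

  degree<n : ∀ v → degree G v < n
  degree<n v = begin
    suc (degree G v)               ≡⟨ weight-closedNeighbourhood v ⟨
    weight (closedNeighbourhood v) ≤⟨ weight-mono-≤ (closedNeighbourhood-≤1 v) ⟩
    weight {n} (const 1)           ≡⟨ weight-ones ⟩
    n                              ∎
    where open ≤-Reasoning

  universal⇒degree≡n∸1 : ∀ {v} → Universal v → degree G v ≡ n ∸ 1
  universal⇒degree≡n∸1 {v} univ = cong (_∸ 1) (begin
    suc (degree G v)               ≡⟨ weight-closedNeighbourhood v ⟨
    weight (closedNeighbourhood v) ≡⟨ weight-cong full ⟩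
    weight {n} (const 1)           ≡⟨ weight-ones ⟩
    n                              ∎)
    where
    open ≡-Reasoning
    full : ∀ u → closedNeighbourhood v u ≡ 1
    full u with u ≟ v
    ... | yes refl = updateAt-updates v _
    ... | no  u≢v  = trans (updateAt-minimal u v _ u≢v) (cong (λ b → if b then 1 else 0) (univ u u≢v))

  degree≡n∸1⇒universal : ∀ {v} → degree G v ≡ n ∸ 1 → Universal v
  degree≡n∸1⇒universal {v} deg≡n∸1 w w≢v with E G v w in vw
  ... | true  = refl
  ... | false = contradiction (begin-strict
    n                              ≤⟨ m≤n+m∸n n 1 ⟩
    suc (n ∸ 1)                    ≡⟨ cong suc deg≡n∸1 ⟨
    suc (degree G v)               ≡⟨ weight-closedNeighbourhood v ⟨
    weight (closedNeighbourhood v) <⟨ weight-mono-< w (closedNeighbourhood-≤1 v) (s≤s (≤-reflexive missing)) ⟩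
    weight {n} (const 1)           ≡⟨ weight-ones ⟩
    n                              ∎) (<-irrefl refl)
    where
    open ≤-Reasoning
    missing : closedNeighbourhood v w ≡ 0
    missing = trans (updateAt-minimal w v _ w≢v) (cong (λ b → if b then 1 else 0) vw)

  multiplicity-isTR2DF : (xs : List (Fin n)) → (∀ x → multiplicity xs x ≤ 2) →
                         (∀ v → v ∉ xs → Dominated (multiplicity xs) v) → NoIsolatedIn xs →
                         IsTR2DF G (multiplicity xs)
  multiplicity-isTR2DF xs ≤2 dominated noIsolated =
    ≤2 , (λ v m≡0 → dominated v (λ v∈xs → multiplicity-∈ v∈xs m≡0)) , total
    where
    total : ∀ v → multiplicity xs v ≢ 0 → ∃[ u ] (Adj G v u × multiplicity xs u ≢ 0)
    total v m≢0 with All.lookup noIsolated (nonzero⇒∈ (multiplicity-supported xs) m≢0)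
    ... | u , u∈xs , vu = u , vu , multiplicity-∈ u∈xs

  universalPair⇒weight2 : ∀ {a b} → a ≢ b → Universal a → Universal b → ∃[ f ] (IsTR2DF G f × weight f ≡ 2)
  universalPair⇒weight2 {a} {b} a≢b univA univB =
      multiplicity ab
    , multiplicity-isTR2DF ab (m≤n⇒m≤1+n ∘ multiplicity-unique-≤1 uniq) dominated noIsolated
    , weight-multiplicity ab
    where
    ab : List (Fin n)
    ab = a ∷ b ∷ []
    uniq : Unique ab
    uniq = (a≢b ∷ []) ∷ [] ∷ []
    dominated : ∀ v → v ∉ ab → Dominated (multiplicity ab) v
    dominated v v∉ab = inj₂ ( a , b , a≢b
                            , Adj-sym (univA v (v∉ab ∘ here)) , Adj-sym (univB v (v∉ab ∘ there ∘ here))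
                            , multiplicity-unique uniq 1st , multiplicity-unique uniq 2nd)
    noIsolated : NoIsolatedIn ab
    noIsolated = (b , 2nd , univA b (≢-sym a≢b)) ∷ (a , 1st , univB a a≢b) ∷ []

  universal⇒weight3 : ∀ {u w} → w ≢ u → Universal u → ∃[ f ] (IsTR2DF G f × weight f ≡ 3)
  universal⇒weight3 {u} {w} w≢u univ =
    multiplicity uuw , multiplicity-isTR2DF uuw ≤2 dominated noIsolated , weight-multiplicity uuw
    where
    uuw : List (Fin n)
    uuw = u ∷ u ∷ w ∷ []
    twoAtU : multiplicity uuw u ≡ 2
    twoAtU = trans (multiplicity-here u (u ∷ w ∷ [])) (cong suc (trans (multiplicity-here u (w ∷ []))
               (cong suc (multiplicity-supported (w ∷ []) u (λ { (here u≡w) → w≢u (sym u≡w) })))))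
    ≤2 : ∀ x → multiplicity uuw x ≤ 2
    ≤2 x with x ≟ u
    ... | yes refl = ≤-reflexive twoAtU
    ... | no  x≢u  = subst (_≤ 2)
                           (sym (trans (multiplicity-there (u ∷ w ∷ []) x≢u) (multiplicity-there (w ∷ []) x≢u)))
                           (m≤n⇒m≤1+n (multiplicity-unique-≤1 {xs = w ∷ []} ([] ∷ []) x))
    dominated : ∀ v → v ∉ uuw → Dominated (multiplicity uuw) v
    dominated v v∉uuw = inj₁ (u , Adj-sym (univ v (v∉uuw ∘ here)) , twoAtU)
    noIsolated : NoIsolatedIn uuw
    noIsolated = (w , 3rd , univ w w≢u) ∷ (w , 3rd , univ w w≢u) ∷ (u , 1st , Adj-sym (univ w w≢u)) ∷ []

  P3orC3⇒noIsolated : ∀ {a b c} → InducesP3 G a b c ⊎ InducesC3 G a b c → NoIsolatedIn (a ∷ b ∷ c ∷ [])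
  P3orC3⇒noIsolated (inj₁ (inj₁ (ab , bc , _)))        = (_ , 2nd , ab) ∷ (_ , 3rd , bc) ∷ (_ , 2nd , Adj-sym bc) ∷ []
  P3orC3⇒noIsolated (inj₁ (inj₂ (inj₁ (ba , ac , _)))) = (_ , 3rd , ac) ∷ (_ , 1st , ba) ∷ (_ , 1st , Adj-sym ac) ∷ []
  P3orC3⇒noIsolated (inj₁ (inj₂ (inj₂ (ac , cb , _)))) = (_ , 3rd , ac) ∷ (_ , 3rd , Adj-sym cb) ∷ (_ , 2nd , cb) ∷ []
  P3orC3⇒noIsolated (inj₂ (ab , bc , _))               = (_ , 2nd , ab) ∷ (_ , 3rd , bc) ∷ (_ , 2nd , Adj-sym bc) ∷ []

  ¬isolated : ∀ {p xs} → ∃[ q ] (q ∈ xs × Adj G p q) → ¬ (∀ {q} → q ∈ xs → p ≢ q → ¬ Adj G p q)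
  ¬isolated (q , q∈xs , pq) notAdj = notAdj q∈xs (Adj⇒≢ pq) pq

  noIsolated⇒P3orC3 : ∀ {a b c} → NoIsolatedIn (a ∷ b ∷ c ∷ []) → InducesP3 G a b c ⊎ InducesC3 G a b c
  noIsolated⇒P3orC3 {a} {b} {c} (na ∷ nb ∷ nc ∷ []) with Adj? a b | Adj? b c | Adj? a c
  ... | yes ab | yes bc | yes ac = inj₂ (ab , bc , ac)
  ... | yes ab | yes bc | no ¬ac = inj₁ (inj₁ (ab , bc , ¬ac))
  ... | yes ab | no ¬bc | yes ac = inj₁ (inj₂ (inj₁ (Adj-sym ab , ac , ¬bc)))
  ... | no ¬ab | yes bc | yes ac = inj₁ (inj₂ (inj₂ (ac , Adj-sym bc , ¬ab)))
  ... | _      | no ¬bc | no ¬ac =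
    ⊥-elim (¬isolated nc λ { 1st _ ca → ¬ac (Adj-sym ca) ; 2nd _ cb → ¬bc (Adj-sym cb) ; 3rd c≢c _ → c≢c refl })
  ... | no ¬ab | _      | no ¬ac =
    ⊥-elim (¬isolated na λ { 1st a≢a _ → a≢a refl ; 2nd _ ab → ¬ab ab ; 3rd _ ac → ¬ac ac })
  ... | no ¬ab | no ¬bc | _      =
    ⊥-elim (¬isolated nb λ { 1st _ ba → ¬ab (Adj-sym ba) ; 2nd b≢b _ → b≢b refl ; 3rd _ bc → ¬bc bc })

  construction⇒weight3 : P3C3Construction G → ∃[ f ] (IsTR2DF G f × weight f ≡ 3)
  construction⇒weight3 (a , b , c , a≢b , b≢c , a≢c , p3orC3 , outside) =
      multiplicity abc
    , multiplicity-isTR2DF abc (m≤n⇒m≤1+n ∘ multiplicity-unique-≤1 uniq) dominated (P3orC3⇒noIsolated p3orC3)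
    , weight-multiplicity abc
    where
    abc : List (Fin n)
    abc = a ∷ b ∷ c ∷ []
    uniq : Unique abc
    uniq = (a≢b ∷ a≢c ∷ []) ∷ (b≢c ∷ []) ∷ [] ∷ []
    one : ∀ {x} → x ∈ abc → multiplicity abc x ≡ 1
    one = multiplicity-unique uniq
    dominated : ∀ v → v ∉ abc → Dominated (multiplicity abc) v
    dominated v v∉abc with outside v (v∉abc ∘ here) (v∉abc ∘ there ∘ here) (v∉abc ∘ there ∘ there ∘ here)
    ... | inj₁ (va , vb)        = inj₂ (a , b , a≢b , va , vb , one 1st , one 2nd)
    ... | inj₂ (inj₁ (va , vc)) = inj₂ (a , c , a≢c , va , vc , one 1st , one 3rd)
    ... | inj₂ (inj₂ (vb , vc)) = inj₂ (b , c , b≢c , vb , vc , one 2nd , one 3rd)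

  nonzeroVertex : ∀ {f} → IsTR2DF G f → Fin n → ∃[ a ] f a ≢ 0
  nonzeroVertex {f} (_ , dominated , _) v with f v ≟ℕ 0
  ... | no  fv≢0 = v , fv≢0
  ... | yes fv≡0 with dominated v fv≡0
  ...   | inj₁ (u , _ , fu≡2)                 = u , 1+n≢0 ∘ trans (sym fu≡2)
  ...   | inj₂ (x , _ , _ , _ , _ , fx≡1 , _) = x , 1+n≢0 ∘ trans (sym fx≡1)

  nonzeroEdge : ∀ {f} → IsTR2DF G f → Fin n → ∃[ a ] ∃[ b ] (Adj G a b × f a ≢ 0 × f b ≢ 0)
  nonzeroEdge tr@(_ , _ , total) v with nonzeroVertex tr v
  ... | a , fa≢0 with total a fa≢0
  ...   | b , ab , fb≢0 = a , b , ab , fa≢0 , fb≢0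

  weight≤2⇒twoUniversal : ∀ {f} → IsTR2DF G f → Fin n → weight f ≤ 2 →
                          ∃[ a ] ∃[ b ] (a ≢ b × Universal a × Universal b)
  weight≤2⇒twoUniversal {f} tr@(_ , dominated , _) v w≤2 with nonzeroEdge tr v
  ... | a , b , ab , fa≢0 , fb≢0 = a , b , Adj⇒≢ ab , universalA , universalB
    where
    pair : List (Fin n)
    pair = a ∷ b ∷ []
    uniq : Unique pair
    uniq = (Adj⇒≢ ab ∷ []) ∷ [] ∷ []
    supp : SupportedOn f pair
    supp = sum≡weight⇒supported uniq (≤-antisym (sum-≤-weight uniq) (≤-trans w≤2 (2≤sum-pair f fa≢0 fb≢0)))
    ones : f a ≡ 1 × f b ≡ 1
    ones = both≡1 (n≢0⇒n>0 fa≢0) (n≢0⇒n>0 fb≢0)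
                  (subst (λ s → f a + s ≤ 2) (+-identityʳ (f b)) (≤-trans (sum-≤-weight uniq) w≤2))
    not2 : ∀ {x} → x ∈ pair → f x ≢ 2
    not2 1st fa≡2 = contradiction (trans (sym (proj₁ ones)) fa≡2) λ ()
    not2 2nd fb≡2 = contradiction (trans (sym (proj₂ ones)) fb≡2) λ ()
    adjacentToBoth : ∀ w → w ∉ pair → Adj G w a × Adj G w b
    adjacentToBoth w w∉pair with dominated w (supp w w∉pair)
    ... | inj₁ (z , _ , fz≡2) = ⊥-elim (not2 (nonzero⇒∈ supp (1+n≢0 ∘ trans (sym fz≡2))) fz≡2)
    ... | inj₂ (x , y , x≢y , wx , wy , fx≡1 , fy≡1)
        with nonzero⇒∈ supp (1+n≢0 ∘ trans (sym fx≡1)) | nonzero⇒∈ supp (1+n≢0 ∘ trans (sym fy≡1))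
    ...   | 1st | 1st = ⊥-elim (x≢y refl)
    ...   | 1st | 2nd = wx , wy
    ...   | 2nd | 1st = wy , wx
    ...   | 2nd | 2nd = ⊥-elim (x≢y refl)
    universalA : Universal a
    universalA w w≢a with w ≟ b
    ... | yes refl = ab
    ... | no  w≢b  = Adj-sym (proj₁ (adjacentToBoth w (All¬⇒¬Any (w≢a ∷ w≢b ∷ []))))
    universalB : Universal b
    universalB w w≢b with w ≟ a
    ... | yes refl = Adj-sym ab
    ... | no  w≢a  = Adj-sym (proj₂ (adjacentToBoth w (All¬⇒¬Any (w≢a ∷ w≢b ∷ []))))

  minimal⇒atMostOneUniversal : (∀ f → IsTR2DF G f → 3 ≤ weight f) → AtMostOneUniversal
  minimal⇒atMostOneUniversal minimal a b univA univB with a ≟ b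
  ... | yes a≡b = a≡b
  ... | no  a≢b with universalPair⇒weight2 a≢b univA univB
  ...   | f , tr , w≡2 = contradiction (subst (3 ≤_) w≡2 (minimal f tr)) λ { (s≤s (s≤s ())) }

  atMostOneUniversal⇒3≤weight : AtMostOneUniversal → Fin n → ∀ f → IsTR2DF G f → 3 ≤ weight f
  atMostOneUniversal⇒3≤weight atMostOne v f tr with 3 ≤? weight f
  ... | yes 3≤w = 3≤w
  ... | no  3≰w with weight≤2⇒twoUniversal tr v (≤-pred (≰⇒> 3≰w))
  ...   | a , b , a≢b , univA , univB = contradiction (atMostOne a b univA univB) a≢b

  weight3∧value2⇒universal : ∀ {f u} → IsTR2DF G f → weight f ≡ 3 → f u ≡ 2 → Universal u
  weight3∧value2⇒universal {f} {u} (_ , dominated , total) w≡3 fu≡2 w w≢u = Adj-sym adjacentToU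
    where
    tooHeavy : ∀ {xs} → Unique (u ∷ xs) → 2 ≤ sum (map f xs) → ⊥
    tooHeavy {xs} uniq 2≤sum = <⇒≱ (n<1+n 3) (begin
      4                    ≤⟨ +-mono-≤ (≤-reflexive (sym fu≡2)) 2≤sum ⟩
      f u + sum (map f xs) ≤⟨ sum-≤-weight uniq ⟩
      weight f             ≡⟨ w≡3 ⟩
      3                    ∎)
      where open ≤-Reasoning
    one≢0 : ∀ {x} → f x ≡ 1 → f x ≢ 0
    one≢0 fx≡1 = 1+n≢0 ∘ trans (sym fx≡1)
    u≢one : ∀ {x} → f x ≡ 1 → u ≢ x
    u≢one fx≡1 refl = contradiction (trans (sym fu≡2) fx≡1) λ ()
    adjacentToU : Adj G w u
    adjacentToU with f w ≟ℕ 0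
    ... | no fw≢0 with total w fw≢0
    ...   | z , wz , fz≢0 with z ≟ u
    ...     | yes refl = wz
    ...     | no  z≢u  = ⊥-elim (tooHeavy ((≢-sym w≢u ∷ ≢-sym z≢u ∷ []) ∷ (Adj⇒≢ wz ∷ []) ∷ [] ∷ [])
                                          (2≤sum-pair f fw≢0 fz≢0))
    adjacentToU | yes fw≡0 with dominated w fw≡0
    ... | inj₁ (z , wz , fz≡2) with z ≟ u
    ...   | yes refl = wz
    ...   | no  z≢u  = ⊥-elim (tooHeavy ((≢-sym z≢u ∷ []) ∷ [] ∷ [])
                                        (≤-trans (≤-reflexive (sym fz≡2)) (m≤m+n (f z) 0)))
    adjacentToU | yes fw≡0 | inj₂ (x , y , x≢y , _ , _ , fx≡1 , fy≡1) =
      ⊥-elim (tooHeavy ((u≢one fx≡1 ∷ u≢one fy≡1 ∷ []) ∷ (x≢y ∷ []) ∷ [] ∷ [])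
                       (2≤sum-pair f (one≢0 fx≡1) (one≢0 fy≡1)))

  total⇒noIsolated : ∀ {f xs} → IsTR2DF G f → SupportedOn f xs → All (λ x → f x ≢ 0) xs → NoIsolatedIn xs
  total⇒noIsolated (_ , _ , total) supp = All.map λ {p} fp≢0 →
    let q , pq , fq≢0 = total p fp≢0 in q , nonzero⇒∈ supp fq≢0 , pq

  distinctNeighbours⇒adjacentToTwoOf : ∀ {v x y a b c} → x ≢ y →
                                       x ∈ (a ∷ b ∷ c ∷ []) → y ∈ (a ∷ b ∷ c ∷ []) →
                                       Adj G v x → Adj G v y → AdjacentToTwoOf v a b c
  distinctNeighbours⇒adjacentToTwoOf x≢y 1st 1st _  _  = ⊥-elim (x≢y refl)
  distinctNeighbours⇒adjacentToTwoOf _   1st 2nd vx vy = inj₁ (vx , vy)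
  distinctNeighbours⇒adjacentToTwoOf _   1st 3rd vx vy = inj₂ (inj₁ (vx , vy))
  distinctNeighbours⇒adjacentToTwoOf _   2nd 1st vx vy = inj₁ (vy , vx)
  distinctNeighbours⇒adjacentToTwoOf x≢y 2nd 2nd _  _  = ⊥-elim (x≢y refl)
  distinctNeighbours⇒adjacentToTwoOf _   2nd 3rd vx vy = inj₂ (inj₂ (vx , vy))
  distinctNeighbours⇒adjacentToTwoOf _   3rd 1st vx vy = inj₂ (inj₁ (vy , vx))
  distinctNeighbours⇒adjacentToTwoOf _   3rd 2nd vx vy = inj₂ (inj₂ (vy , vx))
  distinctNeighbours⇒adjacentToTwoOf x≢y 3rd 3rd _  _  = ⊥-elim (x≢y refl)

  threeOnes⇒construction : ∀ {f a b c} → IsTR2DF G f → (∀ u → f u ≢ 2) →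
    let abc = a ∷ b ∷ c ∷ [] in
    Unique abc → All (λ x → f x ≡ 1) abc → SupportedOn f abc → P3C3Construction G
  threeOnes⇒construction {f} {a} {b} {c} tr@(_ , dominated , _) no2
                         ((a≢b ∷ a≢c ∷ []) ∷ (b≢c ∷ []) ∷ [] ∷ []) ones supp =
      a , b , c , a≢b , b≢c , a≢c
    , noIsolated⇒P3orC3 (total⇒noIsolated tr supp (All.map one≢0 ones))
    , outside
    where
    one≢0 : ∀ {k} → k ≡ 1 → k ≢ 0
    one≢0 k≡1 = 1+n≢0 ∘ trans (sym k≡1)
    outside : ∀ v → v ≢ a → v ≢ b → v ≢ c → AdjacentToTwoOf v a b c
    outside v v≢a v≢b v≢c with dominated v (supp v (All¬⇒¬Any (v≢a ∷ v≢b ∷ v≢c ∷ [])))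
    ... | inj₁ (u , _ , fu≡2) = ⊥-elim (no2 u fu≡2)
    ... | inj₂ (x , y , x≢y , vx , vy , fx≡1 , fy≡1) =
      distinctNeighbours⇒adjacentToTwoOf x≢y (nonzero⇒∈ supp (one≢0 fx≡1)) (nonzero⇒∈ supp (one≢0 fy≡1))
                                         vx vy

  weight3∧no2⇒construction : ∀ {f} → IsTR2DF G f → weight f ≡ 3 → (∀ u → f u ≢ 2) → P3C3Construction G
  weight3∧no2⇒construction tr@(≤2 , _ , _) w≡3 no2 =
    let a , b , c , uniq , ones , supp = weight≡3⇒threeOnes (λ x → ≤-pred (≤∧≢⇒< (≤2 x) (no2 x))) w≡3
    in threeOnes⇒construction tr no2 uniq ones supp

mainTheorem11 : ∀ (n : ℕ) (G : Graph n) → 5 ≤ n → Connected G →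
    (γtR2≡ G 3 ⇔ (ExactlyOneFullVertex G ⊎ (Δ≤ G (n ∸ 2) × P3C3Construction G)))
mainTheorem11 (suc (suc k)) G (s≤s (s≤s _)) _ = mk⇔ to from
  where
  open TotalRoman G

  to : γtR2≡ G 3 → ExactlyOneFullVertex G ⊎ (Δ≤ G k × P3C3Construction G)
  to ((f , tr , w≡3) , minimal) with any? (λ v → degree G v ≟ℕ suc k)
  ... | yes (u , du) = inj₁ (u , du , λ w dw →
          minimal⇒atMostOneUniversal minimal w u (degree≡n∸1⇒universal dw) (degree≡n∸1⇒universal du))
  ... | no noneFull = inj₂ (Δ , weight3∧no2⇒construction tr w≡3 no2)
    where
    Δ : Δ≤ G k
    Δ v = ≤-pred (≤∧≢⇒< (≤-pred (degree<n v)) (noneFull ∘ (v ,_)))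
    no2 : ∀ u → f u ≢ 2
    no2 u fu≡2 = noneFull (u , universal⇒degree≡n∸1 (weight3∧value2⇒universal tr w≡3 fu≡2))

  from : ExactlyOneFullVertex G ⊎ (Δ≤ G k × P3C3Construction G) → γtR2≡ G 3
  from (inj₁ (u , du , unique)) =
      universal⇒weight3 (punchInᵢ≢i u zero) (degree≡n∸1⇒universal du)
    , atMostOneUniversal⇒3≤weight atMostOne zero
    where
    atMostOne : AtMostOneUniversal
    atMostOne a b univA univB =
      trans (unique a (universal⇒degree≡n∸1 univA)) (sym (unique b (universal⇒degree≡n∸1 univB)))
  from (inj₂ (Δ , construction)) =
      construction⇒weight3 construction
    , atMostOneUniversal⇒3≤weight noneUniversal zero
    where
    noneUniversal : AtMostOneUniversal
    noneUniversal a _ univA _ = ⊥-elim (1+n≰n (subst (_≤ k) (universal⇒degree≡n∸1 univA) (Δ a)))
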